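{- Let $G$ be a finite irreducible ordered graph, and suppose that $G$ has at most one irreducible induced ordered subgraph of order $3$ and at most one of order $4$ (up to order-preserving isomorphism). Then $G\in\mathcal{J}$.
   Context: An ordered graph of order $n$ is a graph on vertex set $[n]$ with the natural order. A pair of vertices $u<v$ separates the edges of an ordered graph if every edge $ij$ with $i<j$ has $j\leqslant u$ or $v\leqslant i$; the graph is irreducible if no pair separates its edges. For $n\in\mathbb{N}$: $J^{(n)}_1=K_n$; $J^{(n)}_2$ has vertex set $[n]$ and edge set $\{1n\}$ (empty if $n=1$); $J^{(n)}_3$ has edge set $\{1i:i\in[2,n]\}$; $J^{(n)}_4$ has edge set $\{in:i\in[n-1]\}$; $L^{(n)}$ has edge set $\{i(i+1):i\in[n-1]\}$; $Q_1$ has vertex set $[4]$ and edge set $\{13,24\}$; $Q_2$ has vertex set $[4]$ and edge set $\{14,23\}$. Let $\mathcal{J}_k=\{J^{(n)}_i:i\in[4],n\leqslant k\}\cup\{L^{(n)}:n\leqslant k\}$ for $k=1,2,3$, $\mathcal{J}_k=\{J^{(n)}_i:i\in[4],n\leqslant k\}\cup\{L^{(n)}:n\leqslant k\}\cup\{Q_1,Q_2\}$ for $k\geqslant4$, and $\mathcal{J}=\bigcup_{k\in\mathbb{N}}\mathcal{J}_k$. -}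

module Defs where

open import Data.Nat using (ℕ; suc; _≡ᵇ_)
open import Data.Fin using (Fin; toℕ; _<_; _≤_)
open import Data.Bool using (Bool; true; false; _∧_; _∨_)
open import Data.Product using (Σ; _×_)
open import Data.Sum using (_⊎_)
open import Relation.Nullary using (¬_)
open import Relation.Binary.PropositionalEquality using (_≡_)

-- An ordered graph of order n on vertex set Fin n (vertex i ↔ toℕ i + 1 of [n]),
-- with the natural order. It is given by a Bool-valued function, of which only the
-- values on pairs i < j are meaningful: for i < j, ij is an edge iff G i j ≡ true.
OGraph : ℕ → Set
OGraph n = Fin n → Fin n → Bool

Separates : ∀ {n} → OGraph n → Fin n → Fin n → Set
Separates {n} G u v =
  u < v × ((i j : Fin n) → i < j → G i j ≡ true → (j ≤ u ⊎ v ≤ i))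

Irreducible : ∀ {n} → OGraph n → Set
Irreducible {n} G = (u v : Fin n) → ¬ Separates G u v

-- Order-preserving isomorphism of ordered graphs of the same order.
-- (The only order-preserving bijection Fin n → Fin n is the identity, so two
--  ordered graphs of order n are isomorphic iff they have the same edges.)
_≅_ : ∀ {n} → OGraph n → OGraph n → Set
_≅_ {n} G H = (i j : Fin n) → i < j → G i j ≡ H i j

-- Strictly increasing maps Fin k → Fin n (choice of a k-subset of vertices,
-- listed in increasing order).
StrictlyIncreasing : ∀ {k n} → (Fin k → Fin n) → Set
StrictlyIncreasing {k} f = (i j : Fin k) → i < j → f i < f j

induce : ∀ {k n} → OGraph n → (Fin k → Fin n) → OGraph k
induce G f i j = G (f i) (f j)

AtMostOneIrredInduced : ∀ {n} → ℕ → OGraph n → Set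
AtMostOneIrredInduced {n} k G =
  (f g : Fin k → Fin n) → StrictlyIncreasing f → StrictlyIncreasing g →
  Irreducible (induce G f) → Irreducible (induce G g) →
  induce G f ≅ induce G g

-- The graphs of the family 𝒥 (evaluated on pairs i < j; vertex i is toℕ i + 1).
J₁ : (n : ℕ) → OGraph n
J₁ n i j = true

J₂ : (n : ℕ) → OGraph n        -- edge set {1n}
J₂ n i j = (toℕ i ≡ᵇ 0) ∧ (suc (toℕ j) ≡ᵇ n)

J₃ : (n : ℕ) → OGraph n        -- edge set {1i : i ∈ [2,n]}
J₃ n i j = toℕ i ≡ᵇ 0

J₄ : (n : ℕ) → OGraph n        -- edge set {in : i ∈ [n-1]}
J₄ n i j = suc (toℕ j) ≡ᵇ n

L : (n : ℕ) → OGraph n         -- edge set {i(i+1) : i ∈ [n-1]}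
L n i j = suc (toℕ i) ≡ᵇ toℕ j

-- Q₁ : edges {13, 24};  Q₂ : edges {14, 23}  (used only with n = 4)
Q₁ : (n : ℕ) → OGraph n
Q₁ n i j = ((toℕ i ≡ᵇ 0) ∧ (toℕ j ≡ᵇ 2)) ∨ ((toℕ i ≡ᵇ 1) ∧ (toℕ j ≡ᵇ 3))

Q₂ : (n : ℕ) → OGraph n
Q₂ n i j = ((toℕ i ≡ᵇ 0) ∧ (toℕ j ≡ᵇ 3)) ∨ ((toℕ i ≡ᵇ 1) ∧ (toℕ j ≡ᵇ 2))

InJ : ∀ {n} → OGraph n → Set
InJ {n} G =
  G ≅ J₁ n ⊎ G ≅ J₂ n ⊎ G ≅ J₃ n ⊎ G ≅ J₄ n ⊎ G ≅ L n ⊎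
  (n ≡ 4 × G ≅ Q₁ n) ⊎ (n ≡ 4 × G ≅ Q₂ n)

module Submission where

-- Read G on the vertex numbers 0, …, m. Irreducibility says that every gap between k and k + 1
-- is crossed by an edge; the hypotheses say that all irreducible triples induce the same graph,
-- and so do all 4-sets a < b < c < d with the edge ad or the crossing edges ac and bd.
-- If 0m is an edge, every triple 0 < k < m is irreducible, so the edges at 0 and at m behave like
-- 01 and 1m; the four possibilities give Kₙ, J₃, J₄, and J₂ or, for n = 4, Q₂ (the inner edges
-- are fixed by the triples, in the last case by the 4-sets 0 < a < b < m).
-- If 0m is not an edge and no edge has length at least 2, crossing the gaps forces the path L.
-- Otherwise a long edge ac makes a < a + 1 < c irreducible, which fixes the shape of every
-- irreducible triple. In three of the four shapes, following edges across the gaps produces the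
-- edge 0m. In the fourth (no paths of length 2), walking right from 0 produces crossing edges 0j
-- and xy with 0y absent: for n = 4 this is Q₁, and for n ≥ 5 it contradicts the 4-set condition
-- against a 4-set a < a + 1 < a + 2 < c spanned by an edge of length at least 3.

open import Defs
open import Data.Bool using (Bool; true; false; _∧_; _∨_)
open import Data.Bool.Properties using (¬-not) renaming (_≟_ to _≟ᵇ_)
open import Data.Empty using (⊥; ⊥-elim)
open import Data.Fin using (Fin; zero; suc; toℕ) renaming (_<_ to _<ᶠ_; _≤_ to _≤ᶠ_)
open import Data.Fin.Properties using (toℕ<n; toℕ-fromℕ<; toℕ-injective; any?)
  renaming (<-trans to <ᶠ-trans)
open import Data.List using (List; []; _∷_; length; lookup; map)
open import Data.List.Relation.Unary.Linked as Linked using (Linked; []; [-]; _∷_)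
open import Data.List.Relation.Unary.Linked.Properties using (map⁺)
open import Data.Nat using (ℕ; zero; suc; _+_; _≤_; _<_; _≤?_; _<?_; z≤n; s≤s; z<s; s<s; _≡ᵇ_)
open import Data.Nat.DivMod using (_mod_; m≤n⇒m%n≡m)
open import Data.Nat.Induction using (<-rec)
open import Data.Nat.Properties
open import Data.Product using (∃; ∃₂; _×_; _,_; proj₁; proj₂; uncurry; map₂)
open import Data.Sum using (_⊎_; inj₁; inj₂)
import Data.Sum as Sum
open import Relation.Nullary using (¬_; Dec; yes; no; _×-dec_)
open import Relation.Nullary.Decidable using (map′)
open import Relation.Binary.PropositionalEquality

-- Ordered graphs on vertex numbers; a graph of order m + 1 is only ever read at a < b ≤ m.
Adj : Set
Adj = ℕ → ℕ → Bool

GapsCrossed : ℕ → Adj → Set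
GapsCrossed m g = ∀ {k} → k < m → ∃₂ λ i j → i ≤ k × k < j × j ≤ m × g i j ≡ true

Irreducible₃ : Adj → ℕ → ℕ → ℕ → Set
Irreducible₃ g a b c = g a c ≡ true ⊎ (g a b ≡ true × g b c ≡ true)

-- Either disjunct makes the graph induced on a < b < c < d irreducible.
Crossing₄ : Adj → ℕ → ℕ → ℕ → ℕ → Set
Crossing₄ g a b c d = g a d ≡ true ⊎ (g a c ≡ true × g b d ≡ true)

UniqueIrreducible₃ : ℕ → Adj → Set
UniqueIrreducible₃ m g = ∀ {a b c a′ b′ c′} →
  a < b → b < c → c ≤ m → a′ < b′ → b′ < c′ → c′ ≤ m →
  Irreducible₃ g a b c → Irreducible₃ g a′ b′ c′ →
  g a b ≡ g a′ b′ × g a c ≡ g a′ c′ × g b c ≡ g b′ c′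

UniqueCrossing₄ : ℕ → Adj → Set
UniqueCrossing₄ m g = ∀ {a b c d a′ b′ c′ d′} →
  a < b → b < c → c < d → d ≤ m → a′ < b′ → b′ < c′ → c′ < d′ → d′ ≤ m →
  Crossing₄ g a b c d → Crossing₄ g a′ b′ c′ d′ →
  g b c ≡ g b′ c′ × g a d ≡ g a′ d′

Agree : ℕ → Adj → Adj → Set
Agree m g h = ∀ {a b} → a < b → b ≤ m → g a b ≡ h a b

-- J₂ (suc m) i j of Defs reduces to J₂ᴺ m (toℕ i) (toℕ j), and likewise for the others.
J₁ᴺ J₂ᴺ J₃ᴺ J₄ᴺ Lᴺ Q₁ᴺ Q₂ᴺ : ℕ → Adj
J₁ᴺ m a b = true
J₂ᴺ m a b = (a ≡ᵇ 0) ∧ (b ≡ᵇ m)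
J₃ᴺ m a b = a ≡ᵇ 0
J₄ᴺ m a b = b ≡ᵇ m
Lᴺ m a b = suc a ≡ᵇ b
Q₁ᴺ m a b = ((a ≡ᵇ 0) ∧ (b ≡ᵇ 2)) ∨ ((a ≡ᵇ 1) ∧ (b ≡ᵇ 3))
Q₂ᴺ m a b = ((a ≡ᵇ 0) ∧ (b ≡ᵇ 3)) ∨ ((a ≡ᵇ 1) ∧ (b ≡ᵇ 2))

InJᴺ : ℕ → Adj → Set
InJᴺ m g =
  Agree m g (J₁ᴺ m) ⊎ Agree m g (J₂ᴺ m) ⊎ Agree m g (J₃ᴺ m) ⊎ Agree m g (J₄ᴺ m) ⊎
  Agree m g (Lᴺ m) ⊎ (suc m ≡ 4 × Agree m g (Q₁ᴺ m)) ⊎ (suc m ≡ 4 × Agree m g (Q₂ᴺ m))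

≡ᵇ-refl : ∀ n → (n ≡ᵇ n) ≡ true
≡ᵇ-refl zero = refl
≡ᵇ-refl (suc n) = ≡ᵇ-refl n

<⇒≡ᵇ-false : ∀ {m n} → m < n → (m ≡ᵇ n) ≡ false
<⇒≡ᵇ-false {zero} {suc n} _ = refl
<⇒≡ᵇ-false {suc m} {suc n} (s≤s m<n) = <⇒≡ᵇ-false m<n

true≢false : ∀ {b} → b ≡ true → b ≢ false
true≢false refl ()

agree-by-position : ∀ {m g h} → g 0 m ≡ h 0 m →
  (∀ {k} → 0 < k → k < m → g 0 k ≡ h 0 k) →
  (∀ {k} → 0 < k → k < m → g k m ≡ h k m) →
  (∀ {a b} → 0 < a → a < b → b < m → g a b ≡ h a b) →
  Agree m g h
agree-by-position outer left right inner {zero} 0<b b≤m with m≤n⇒m<n∨m≡n b≤m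
... | inj₁ b<m = left 0<b b<m
... | inj₂ refl = outer
agree-by-position outer left right inner {suc a} a<b b≤m with m≤n⇒m<n∨m≡n b≤m
... | inj₁ b<m = inner z<s a<b b<m
... | inj₂ refl = right z<s a<b

module OuterEdge {m g} (unique₃ : UniqueIrreducible₃ m g) (g0m : g 0 m ≡ true) (1<m : 1 < m) where

  -- The edge 0m makes every triple 0 < k < m irreducible, so each is shaped like 0 < 1 < m.
  left-edge : ∀ {k} → 0 < k → k < m → g 0 k ≡ g 0 1
  left-edge 0<k k<m with unique₃ 0<k k<m ≤-refl z<s 1<m ≤-refl (inj₁ g0m) (inj₁ g0m)
  ... | e , _ , _ = e

  right-edge : ∀ {k} → 0 < k → k < m → g k m ≡ g 1 m
  right-edge 0<k k<m with unique₃ 0<k k<m ≤-refl z<s 1<m ≤-refl (inj₁ g0m) (inj₁ g0m)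
  ... | _ , _ , e = e

  inner-edge-if-right : g 1 m ≡ true → ∀ {a b} → 0 < a → a < b → b < m → g a b ≡ g 0 1
  inner-edge-if-right r 0<a a<b b<m with
    unique₃ a<b b<m ≤-refl z<s 1<m ≤-refl
      (inj₁ (trans (right-edge 0<a (<-trans a<b b<m)) r)) (inj₁ g0m)
  ... | e , _ , _ = e

  inner-edge-if-left : g 0 1 ≡ true → ∀ {a b} → 0 < a → a < b → b < m →
    g a b ≡ true → g 1 m ≡ true
  inner-edge-if-left l 0<a a<b b<m gab with
    unique₃ 0<a a<b (<⇒≤ b<m) z<s 1<m ≤-refl
      (inj₂ (trans (left-edge 0<a (<-trans a<b b<m)) l , gab)) (inj₁ g0m)
  ... | _ , _ , e = trans (sym e) gab

  agree-J₁ : g 0 1 ≡ true → g 1 m ≡ true → Agree m g (J₁ᴺ m)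
  agree-J₁ l r = agree-by-position g0m
    (λ p q → trans (left-edge p q) l)
    (λ p q → trans (right-edge p q) r)
    (λ p q s → trans (inner-edge-if-right r p q s) l)

  agree-J₃ : g 0 1 ≡ true → g 1 m ≡ false → Agree m g (J₃ᴺ m)
  agree-J₃ l r = agree-by-position g0m (λ p q → trans (left-edge p q) l) right inner
    where
    right : ∀ {k} → 0 < k → k < m → g k m ≡ J₃ᴺ m k m
    right {suc k} p q = trans (right-edge p q) r
    inner : ∀ {a b} → 0 < a → a < b → b < m → g a b ≡ J₃ᴺ m a b
    inner {suc a} p q s = ¬-not λ gab → true≢false (inner-edge-if-left l p q s gab) r

  agree-J₄ : g 0 1 ≡ false → g 1 m ≡ true → Agree m g (J₄ᴺ m)
  agree-J₄ l r = agree-by-position (trans g0m (sym (≡ᵇ-refl m)))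
    (λ p q → trans (trans (left-edge p q) l) (sym (<⇒≡ᵇ-false q)))
    (λ p q → trans (trans (right-edge p q) r) (sym (≡ᵇ-refl m)))
    (λ p q s → trans (trans (inner-edge-if-right r p q s) l) (sym (<⇒≡ᵇ-false s)))

  agree-J₂ : g 0 1 ≡ false → g 1 m ≡ false →
    (∀ {a b} → 0 < a → a < b → b < m → g a b ≡ false) → Agree m g (J₂ᴺ m)
  agree-J₂ l r no-inner = agree-by-position (trans g0m (sym (≡ᵇ-refl m)))
    (λ p q → trans (trans (left-edge p q) l) (sym (<⇒≡ᵇ-false q))) right inner
    where
    right : ∀ {k} → 0 < k → k < m → g k m ≡ J₂ᴺ m k m
    right {suc k} p q = trans (right-edge p q) r
    inner : ∀ {a b} → 0 < a → a < b → b < m → g a b ≡ J₂ᴺ m a b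
    inner {suc a} = no-inner

no-inner-pair-below-2 : ∀ {a b} → 0 < a → a < b → b < 2 → ⊥
no-inner-pair-below-2 0<a a<b b<2 = <⇒≱ (≤-trans (s≤s 0<a) a<b) (≤-pred b<2)

inner-pair-below-3 : ∀ {a b} → 0 < a → a < b → b < 3 → a ≡ 1 × b ≡ 2
inner-pair-below-3 0<a a<b b<3 =
  ≤-antisym (≤-pred (≤-trans a<b (≤-pred b<3))) 0<a ,
  ≤-antisym (≤-pred b<3) (≤-trans (s≤s 0<a) a<b)

bare-outer-edge-case : ∀ m g → UniqueIrreducible₃ m g → UniqueCrossing₄ m g →
  g 0 m ≡ true → 1 < m → g 0 1 ≡ false → g 1 m ≡ false → InJᴺ m g
bare-outer-edge-case 1 g unique₃ unique₄ g0m (s≤s ()) l r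
bare-outer-edge-case 2 g unique₃ unique₄ g0m 1<m l r =
  inj₂ (inj₁ (agree-J₂ l r λ p q s → ⊥-elim (no-inner-pair-below-2 p q s)))
  where open OuterEdge unique₃ g0m 1<m
bare-outer-edge-case 3 g unique₃ unique₄ g0m 1<m l r = by-inner-edge (g 1 2) refl
  where
  open OuterEdge unique₃ g0m 1<m
  by-inner-edge : ∀ b → g 1 2 ≡ b → InJᴺ 3 g
  by-inner-edge false e = inj₂ (inj₁ (agree-J₂ l r inner))
    where
    inner : ∀ {a b} → 0 < a → a < b → b < 3 → g a b ≡ false
    inner p q s with inner-pair-below-3 p q s
    ... | refl , refl = e
  by-inner-edge true e = inj₂ (inj₂ (inj₂ (inj₂ (inj₂ (inj₂ (refl , Q₂-table))))))
    where
    Q₂-table : Agree 3 g (Q₂ᴺ 3)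
    Q₂-table {0} {1} _ _ = l
    Q₂-table {0} {2} _ _ = trans (left-edge z<s (s<s (s<s z<s))) l
    Q₂-table {0} {3} _ _ = g0m
    Q₂-table {1} {2} _ _ = e
    Q₂-table {1} {3} _ _ = r
    Q₂-table {2} {3} _ _ = trans (right-edge z<s (s<s (s<s z<s))) r
    Q₂-table {_} {suc (suc (suc (suc _)))} _ (s≤s (s≤s (s≤s ())))
    Q₂-table {_} {0} () _
    Q₂-table {suc _} {1} (s≤s ()) _
    Q₂-table {suc (suc _)} {2} (s≤s (s≤s ())) _
    Q₂-table {suc (suc (suc _))} {3} (s≤s (s≤s (s≤s ()))) _
bare-outer-edge-case m@(suc (suc (suc (suc _)))) g unique₃ unique₄ g0m 1<m l r =
  inj₂ (inj₁ (agree-J₂ l r λ p q s → trans (like-1-2 p q s) g12-false))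
  where
  open OuterEdge unique₃ g0m 1<m
  like-1-2 : ∀ {a b} → 0 < a → a < b → b < m → g a b ≡ g 1 2
  like-1-2 p q s with
    unique₄ p q s ≤-refl z<s (s<s z<s) (s<s (s<s z<s)) ≤-refl (inj₁ g0m) (inj₁ g0m)
  ... | e , _ = e
  -- Otherwise 1 < 2 < 3 is an irreducible triangle, unlike 0 < 1 < m.
  g12-false : g 1 2 ≡ false
  g12-false = ¬-not λ g12 → true≢false g12
    (trans (proj₁ (unique₃ (s<s z<s) (s<s (s<s z<s)) (s≤s (s≤s (s≤s z≤n))) z<s 1<m ≤-refl
                    (inj₁ (trans (like-1-2 z<s (s<s z<s) (s<s (s<s (s<s z<s)))) g12)) (inj₁ g0m)))
           l)

outer-edge-case : ∀ m g → UniqueIrreducible₃ m g → UniqueCrossing₄ m g →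
  g 0 m ≡ true → 1 < m → InJᴺ m g
outer-edge-case m g unique₃ unique₄ g0m 1<m = by-end-edges (g 0 1) (g 1 m) refl refl
  where
  open OuterEdge unique₃ g0m 1<m
  by-end-edges : ∀ p q → g 0 1 ≡ p → g 1 m ≡ q → InJᴺ m g
  by-end-edges true true l r = inj₁ (agree-J₁ l r)
  by-end-edges true false l r = inj₂ (inj₂ (inj₁ (agree-J₃ l r)))
  by-end-edges false true l r = inj₂ (inj₂ (inj₂ (inj₁ (agree-J₄ l r))))
  by-end-edges false false l r = bare-outer-edge-case m g unique₃ unique₄ g0m 1<m l r

LongEdge : ℕ → Adj → Set
LongEdge m g = ∃₂ λ a c → 2 + a ≤ c × c ≤ m × g a c ≡ true

long-edge? : ∀ m g → Dec (LongEdge m g)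
long-edge? m g = map′ from to
  (anyUpTo? (λ c → anyUpTo? (λ a → (2 + a ≤? c) ×-dec (g a c ≟ᵇ true)) c) (suc m))
  where
  from : (∃ λ c → c < suc m × ∃ λ a → a < c × 2 + a ≤ c × g a c ≡ true) → LongEdge m g
  from (c , c<1+m , a , _ , 2+a≤c , e) = a , c , 2+a≤c , ≤-pred c<1+m , e
  to : LongEdge m g → ∃ λ c → c < suc m × ∃ λ a → a < c × 2 + a ≤ c × g a c ≡ true
  to (a , c , 2+a≤c , c≤m , e) = c , s≤s c≤m , a , <-trans (n<1+n a) 2+a≤c , 2+a≤c , e

no-long-edge⇒path : ∀ {m g} → GapsCrossed m g → ¬ LongEdge m g → Agree m g (Lᴺ m)
no-long-edge⇒path {g = g} gaps short {a} a<b b≤m with m≤n⇒m<n∨m≡n a<b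
... | inj₁ 1+a<b = trans (¬-not λ e → short (a , _ , 1+a<b , b≤m , e)) (sym (<⇒≡ᵇ-false 1+a<b))
... | inj₂ refl with gaps b≤m
...   | i , j , i≤a , a<j , j≤m , e =
  trans (subst₂ (λ u v → g u v ≡ true) i≡a j≡1+a e) (sym (≡ᵇ-refl (suc a)))
  where
  j≤1+i : j ≤ suc i
  j≤1+i = ≮⇒≥ λ 1+i<j → short (i , j , 1+i<j , j≤m , e)
  i≡a : i ≡ a
  i≡a = ≤-antisym i≤a (≤-pred (≤-trans a<j j≤1+i))
  j≡1+a : j ≡ suc a
  j≡1+a = ≤-antisym (≤-trans j≤1+i (s≤s i≤a)) a<j

TriplesShaped : ℕ → Adj → Bool → Bool → Set
TriplesShaped m g p q = ∀ {x y z} → x < y → y < z → z ≤ m → Irreducible₃ g x y z →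
  g x y ≡ p × g x z ≡ true × g y z ≡ q

long-edge⇒shaped : ∀ {m g a c} → UniqueIrreducible₃ m g → 2 + a ≤ c → c ≤ m → g a c ≡ true →
  TriplesShaped m g (g a (suc a)) (g (suc a) c)
long-edge⇒shaped unique₃ 2+a≤c c≤m gac x<y y<z z≤m irr
  with unique₃ x<y y<z z≤m (n<1+n _) 2+a≤c c≤m irr (inj₁ gac)
... | exy , exz , eyz = exy , trans exz gac , eyz

module _ {m : ℕ} {g : Adj} where

  shorten-right : ∀ {q} → TriplesShaped m g true q → ∀ {x y z} → x < y → y ≤ z → z ≤ m →
    g x z ≡ true → g x y ≡ true
  shorten-right shaped x<y y≤z z≤m exz with m≤n⇒m<n∨m≡n y≤z
  ... | inj₁ y<z = proj₁ (shaped x<y y<z z≤m (inj₁ exz))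
  ... | inj₂ refl = exz

  shorten-left : ∀ {p} → TriplesShaped m g p true → ∀ {x y z} → x ≤ y → y < z → z ≤ m →
    g x z ≡ true → g y z ≡ true
  shorten-left shaped x≤y y<z z≤m exz with m≤n⇒m<n∨m≡n x≤y
  ... | inj₁ x<y = proj₂ (proj₂ (shaped x<y y<z z≤m (inj₁ exz)))
  ... | inj₂ refl = exz

  -- Every 0 < k ≤ m is joined to 0: an edge xy crossing the gap at k - 1 yields the edge 0y
  -- (directly, or through the path 0xy), which shortens to 0k.
  triangles⇒outer-edge : GapsCrossed m g → 0 < m → TriplesShaped m g true true → g 0 m ≡ true
  triangles⇒outer-edge gaps 0<m shaped = <-rec Reaches step m 0<m ≤-refl
    where
    Reaches : ℕ → Set
    Reaches k = 0 < k → k ≤ m → g 0 k ≡ true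
    step : ∀ k → (∀ {x} → x < k → Reaches x) → Reaches k
    step (suc k) reaches _ 1+k≤m with gaps 1+k≤m
    ... | x , y , x≤k , k<y , y≤m , exy = shorten-right shaped z<s k<y y≤m (joined x x≤k exy)
      where
      joined : ∀ x → x ≤ k → g x y ≡ true → g 0 y ≡ true
      joined zero _ e = e
      joined (suc x) x≤k e = proj₁ (proj₂ (shaped z<s (≤-<-trans x≤k k<y) y≤m
        (inj₂ (reaches (s≤s x≤k) z<s (<⇒≤ (≤-<-trans x≤k 1+k≤m)) , e))))

-- The gap at m - 1 is crossed by an edge im; if 0 < i, the edge xi obtained from the gap at
-- i - 1 makes x < i < m an irreducible triple containing its last pair im.
left-forks⇒outer-edge : ∀ {m g} → GapsCrossed m g → 0 < m → TriplesShaped m g true false →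
  g 0 m ≡ true
left-forks⇒outer-edge {suc n} {g} gaps _ shaped with gaps (n<1+n n)
... | i , j , i≤n , n<j , j≤1+n , e with ≤-antisym j≤1+n n<j
...   | refl = from-start i i≤n e
  where
  from-start : ∀ i → i ≤ n → g i (suc n) ≡ true → g 0 (suc n) ≡ true
  from-start zero _ e = e
  from-start (suc i) i<n e with gaps (m<n⇒m<1+n i<n)
  ... | x , y , x≤i , i<y , y≤m , exy = ⊥-elim (true≢false e
    (proj₂ (proj₂ (shaped (s≤s x≤i) (s≤s i<n) ≤-refl
      (inj₂ (shorten-right shaped (s≤s x≤i) i<y y≤m exy , e))))))

-- Mirror image: the gap at 0 is crossed by an edge 0j; if j < m, the edge jy obtained from the
-- gap at j makes 0 < j < y an irreducible triple containing its first pair 0j.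
right-forks⇒outer-edge : ∀ {m g} → GapsCrossed m g → 0 < m → TriplesShaped m g false true →
  g 0 m ≡ true
right-forks⇒outer-edge {m} {g} gaps 0<m shaped with gaps 0<m
... | zero , j , _ , 0<j , j≤m , e with m≤n⇒m<n∨m≡n j≤m
...   | inj₂ refl = e
...   | inj₁ j<m with gaps j<m
...     | x , y , x≤j , j<y , y≤m , exy = ⊥-elim (true≢false e
  (proj₁ (shaped 0<j j<y y≤m (inj₂ (e , shorten-left shaped x≤j j<y y≤m exy)))))

CrossingFromStart : ℕ → Adj → Set
CrossingFromStart m g = ∃₂ λ x j → ∃ λ y →
  0 < x × x < j × j < y × y ≤ m × g 0 j ≡ true × g x y ≡ true × g 0 y ≡ false

crossing-from-start⇒3≤m : ∀ {m g} → CrossingFromStart m g → 3 ≤ m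
crossing-from-start⇒3≤m (_ , _ , _ , 0<x , x<j , j<y , y≤m , _) =
  ≤-trans (≤-trans (s≤s (≤-trans (s≤s 0<x) x<j)) j<y) y≤m

short-edge-over-3 : ∀ {a b} → a ≤ 3 → 3 < b → ¬ (3 + a ≤ b) → a ≡ 2 ⊎ a ≡ 3
short-edge-over-3 {0} _ 3<b short = ⊥-elim (short (<⇒≤ 3<b))
short-edge-over-3 {1} _ 3<b short = ⊥-elim (short 3<b)
short-edge-over-3 {2} _ _ _ = inj₁ refl
short-edge-over-3 {3} _ _ _ = inj₂ refl
short-edge-over-3 {suc (suc (suc (suc _)))} (s≤s (s≤s (s≤s ()))) _ _

module OnlyLongEdges {m g} (gaps : GapsCrossed m g) (g0m : g 0 m ≡ false)
                     (shaped : TriplesShaped m g false false) where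

  no-path : ∀ {x y z} → x < y → y < z → z ≤ m → g x y ≡ true → g y z ≡ true → ⊥
  no-path x<y y<z z≤m exy eyz = true≢false exy (proj₁ (shaped x<y y<z z≤m (inj₂ (exy , eyz))))

  -- Walk to the right along edges from 0; the walk stops at j < m when the edge xy crossing
  -- the gap at j does not end in a neighbour of 0, and then 0 < x < j since paths are excluded.
  walk : ∀ fuel {j} → m ≤ fuel + j → 0 < j → j ≤ m → g 0 j ≡ true → CrossingFromStart m g
  walk zero m≤j _ j≤m e0j with ≤-antisym j≤m m≤j
  ... | refl = ⊥-elim (true≢false e0j g0m)
  walk (suc fuel) {j} m≤fuel+1+j 0<j j≤m e0j with m≤n⇒m<n∨m≡n j≤m
  ... | inj₂ refl = ⊥-elim (true≢false e0j g0m)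
  ... | inj₁ j<m with gaps j<m
  ...   | x , y , x≤j , j<y , y≤m , exy with g 0 y in e0y
  ...     | true = walk fuel m≤fuel+y (≤-trans 0<j (<⇒≤ j<y)) y≤m e0y
    where
    m≤fuel+y : m ≤ fuel + y
    m≤fuel+y = ≤-trans m≤fuel+1+j (subst (_≤ fuel + y) (+-suc fuel j) (+-monoʳ-≤ fuel j<y))
  ...     | false = stop x x≤j exy
    where
    stop : ∀ x → x ≤ j → g x y ≡ true → CrossingFromStart m g
    stop zero _ e0y′ = ⊥-elim (true≢false e0y′ e0y)
    stop (suc x) x≤j exy with m≤n⇒m<n∨m≡n x≤j
    ... | inj₁ x<j = suc x , j , y , z<s , x<j , j<y , y≤m , e0j , exy , e0y
    ... | inj₂ refl = ⊥-elim (no-path 0<j j<y y≤m e0j exy)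

  crossing-from-start : 0 < m → CrossingFromStart m g
  crossing-from-start 0<m with gaps 0<m
  ... | zero , j , _ , 0<j , j≤m , e0j = walk m (m≤m+n m j) 0<j j≤m e0j

  -- 0j or xy has length at least 3 unless (x, j, y) = (1, 2, 3); then the edge crossing the gap
  -- at 3 is long enough, because from 2 or 3 it would extend the edge 02 or 13 to a path.
  long₃-edge : 3 < m → CrossingFromStart m g → ∃₂ λ a c → 3 + a ≤ c × c ≤ m × g a c ≡ true
  long₃-edge 3<m (x , j , y , 0<x , x<j , j<y , y≤m , e0j , exy , _) with 3 ≤? j
  ... | yes 3≤j = 0 , j , 3≤j , ≤-trans (<⇒≤ j<y) y≤m , e0j
  ... | no j≱3 with inner-pair-below-3 0<x x<j (≰⇒> j≱3)
  ...   | refl , refl with 4 ≤? y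
  ...     | yes 4≤y = 1 , y , 4≤y , y≤m , exy
  ...     | no y≱4 with ≤-antisym (≤-pred (≰⇒> y≱4)) j<y
  ...       | refl with gaps 3<m
  ...         | a , b , a≤3 , 3<b , b≤m , eab with 3 + a ≤? b
  ...           | yes long = a , b , long , b≤m , eab
  ...           | no short with short-edge-over-3 a≤3 3<b short
  ...             | inj₁ refl = ⊥-elim (no-path z<s (<-trans (n<1+n 2) 3<b) b≤m e0j eab)
  ...             | inj₂ refl = ⊥-elim (no-path (s<s z<s) 3<b b≤m exy eab)

  -- The 4-sets a < a + 1 < a + 2 < c and 0 < x < j < y disagree on their outer pair.
  no-crossing-from-start : UniqueCrossing₄ m g → 3 < m → ¬ CrossingFromStart m g
  no-crossing-from-start unique₄ 3<m crossing@(x , j , y , 0<x , x<j , j<y , y≤m , e0j , exy , e0y)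
    with long₃-edge 3<m crossing
  ... | a , c , 3+a≤c , c≤m , eac = true≢false eac
    (trans (proj₂ (unique₄ (n<1+n a) (n<1+n (suc a)) 3+a≤c c≤m 0<x x<j j<y y≤m
                     (inj₁ eac) (inj₂ (e0j , exy))))
           e0y)

open OnlyLongEdges using (crossing-from-start; no-crossing-from-start)

crossing-from-start⇒Q₁ : ∀ {g} → TriplesShaped 3 g false false → CrossingFromStart 3 g →
  Agree 3 g (Q₁ᴺ 3)
crossing-from-start⇒Q₁ {g} shaped (x , j , y , 0<x , x<j , j<y , y≤3 , e0j , exy , e0y)
  with inner-pair-below-3 0<x x<j (<-≤-trans j<y y≤3)
... | refl , refl with ≤-antisym y≤3 j<y
...   | refl = table
  where
  table : Agree 3 g (Q₁ᴺ 3)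
  table {0} {1} _ _ = proj₁ (shaped z<s (s<s z<s) (s≤s (s≤s z≤n)) (inj₁ e0j))
  table {0} {2} _ _ = e0j
  table {0} {3} _ _ = e0y
  table {1} {2} _ _ = proj₂ (proj₂ (shaped z<s (s<s z<s) (s≤s (s≤s z≤n)) (inj₁ e0j)))
  table {1} {3} _ _ = exy
  table {2} {3} _ _ = proj₂ (proj₂ (shaped (s<s z<s) (s<s (s<s z<s)) ≤-refl (inj₁ exy)))
  table {_} {suc (suc (suc (suc _)))} _ (s≤s (s≤s (s≤s ())))
  table {_} {0} () _
  table {suc _} {1} (s≤s ()) _
  table {suc (suc _)} {2} (s≤s (s≤s ())) _
  table {suc (suc (suc _))} {3} (s≤s (s≤s (s≤s ()))) _

only-long-edges : ∀ m g → GapsCrossed m g → UniqueCrossing₄ m g → g 0 m ≡ false → 0 < m →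
  TriplesShaped m g false false → InJᴺ m g
only-long-edges m g gaps unique₄ g0m 0<m shaped with crossing-from-start gaps g0m shaped 0<m
... | crossing with m≤n⇒m<n∨m≡n (crossing-from-start⇒3≤m crossing)
...   | inj₁ 3<m = ⊥-elim (no-crossing-from-start gaps g0m shaped unique₄ 3<m crossing)
...   | inj₂ refl =
  inj₂ (inj₂ (inj₂ (inj₂ (inj₂ (inj₁ (refl , crossing-from-start⇒Q₁ shaped crossing))))))

long-edge-case : ∀ {m g p q} → GapsCrossed m g → UniqueCrossing₄ m g → g 0 m ≡ false → 0 < m →
  TriplesShaped m g p q → InJᴺ m g
long-edge-case {p = true} {true} gaps _ g0m 0<m shaped =
  ⊥-elim (true≢false (triangles⇒outer-edge gaps 0<m shaped) g0m)
long-edge-case {p = true} {false} gaps _ g0m 0<m shaped =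
  ⊥-elim (true≢false (left-forks⇒outer-edge gaps 0<m shaped) g0m)
long-edge-case {p = false} {true} gaps _ g0m 0<m shaped =
  ⊥-elim (true≢false (right-forks⇒outer-edge gaps 0<m shaped) g0m)
long-edge-case {p = false} {false} gaps unique₄ g0m 0<m shaped =
  only-long-edges _ _ gaps unique₄ g0m 0<m shaped

classifyᴺ : ∀ m g → GapsCrossed m g → UniqueIrreducible₃ m g → UniqueCrossing₄ m g → InJᴺ m g
classifyᴺ zero g _ _ _ = inj₁ λ a<b b≤0 → ⊥-elim (<⇒≱ a<b (≤-trans b≤0 z≤n))
classifyᴺ (suc m) g gaps unique₃ unique₄ with g 0 (suc m) in g0m
classifyᴺ 1 g gaps unique₃ unique₄ | true = inj₁ (agree-by-position {g = g} g0m
  (λ 0<k k<1 → ⊥-elim (<⇒≱ k<1 0<k))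
  (λ 0<k k<1 → ⊥-elim (<⇒≱ k<1 0<k))
  (λ 0<a a<b b<1 → ⊥-elim (<⇒≱ (<-trans a<b b<1) 0<a)))
classifyᴺ (suc (suc m)) g gaps unique₃ unique₄ | true =
  outer-edge-case _ g unique₃ unique₄ g0m (s<s z<s)
classifyᴺ (suc m) g gaps unique₃ unique₄ | false with long-edge? (suc m) g
... | no short = inj₂ (inj₂ (inj₂ (inj₂ (inj₁ (no-long-edge⇒path gaps short)))))
... | yes (a , c , 2+a≤c , c≤m , eac) =
  long-edge-case gaps unique₄ g0m z<s (long-edge⇒shaped unique₃ 2+a≤c c≤m eac)

crossing-edge⇒¬separates : ∀ {k} (H : OGraph k) {u v} i j → i <ᶠ j → H i j ≡ true →
  toℕ i ≤ toℕ u → toℕ u < toℕ j → ¬ Separates H u v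
crossing-edge⇒¬separates H i j i<j e i≤u u<j (u<v , separated) with separated i j i<j e
... | inj₁ j≤u = <⇒≱ u<j j≤u
... | inj₂ v≤i = <⇒≱ u<v (≤-trans v≤i i≤u)

lookup-increasing : ∀ {n} {xs : List (Fin n)} → Linked _<ᶠ_ xs → StrictlyIncreasing (lookup xs)
lookup-increasing {xs = _ ∷ _} xs↗ zero (suc j) _ =
  Linked.lookup <ᶠ-trans (Linked.tail xs↗) (Linked.head′ xs↗) j
lookup-increasing {xs = _ ∷ _} xs↗ (suc i) (suc j) (s<s i<j) =
  lookup-increasing (Linked.tail xs↗) i j i<j

module OnVertexNumbers {m} (G : OGraph (suc m)) where

  -- Numbers above m wrap around (junk); only 0, …, m are ever used as vertices.
  vertex : ℕ → Fin (suc m)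
  vertex a = a mod suc m

  adj : Adj
  adj a b = G (vertex a) (vertex b)

  toℕ-vertex : ∀ {a} → a ≤ m → toℕ (vertex a) ≡ a
  toℕ-vertex {a} a≤m = trans (toℕ-fromℕ< _) (m≤n⇒m%n≡m a≤m)

  adj-toℕ : ∀ i j → adj (toℕ i) (toℕ j) ≡ G i j
  adj-toℕ i j = cong₂ G (vertex-toℕ i) (vertex-toℕ j)
    where
    vertex-toℕ : ∀ i → vertex (toℕ i) ≡ i
    vertex-toℕ i = toℕ-injective (toℕ-vertex (≤-pred (toℕ<n i)))

  below : ∀ {a b} → a < b → b ≤ m → a ≤ m
  below a<b b≤m = <⇒≤ (<-≤-trans a<b b≤m)

  vertex-mono-< : ∀ {a b} → a < b → b ≤ m → vertex a <ᶠ vertex b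
  vertex-mono-< a<b b≤m = subst₂ _<_ (sym (toℕ-vertex (below a<b b≤m))) (sym (toℕ-vertex b≤m)) a<b

  vertices : (xs : List ℕ) → Fin (length (map vertex xs)) → Fin (suc m)
  vertices xs = lookup (map vertex xs)

  subgraph : (xs : List ℕ) → OGraph (length (map vertex xs))
  subgraph xs = induce G (vertices xs)

  vertices-increasing : ∀ {xs} → Linked (λ a b → a < b × b ≤ m) xs →
    StrictlyIncreasing (vertices xs)
  vertices-increasing xs↗ = lookup-increasing (map⁺ (Linked.map (uncurry vertex-mono-<) xs↗))

  increasing₃ : ∀ {a b c} → a < b → b < c → c ≤ m →
    StrictlyIncreasing (vertices (a ∷ b ∷ c ∷ []))
  increasing₃ a<b b<c c≤m = vertices-increasing ((a<b , below b<c c≤m) ∷ (b<c , c≤m) ∷ [-])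

  increasing₄ : ∀ {a b c d} → a < b → b < c → c < d → d ≤ m →
    StrictlyIncreasing (vertices (a ∷ b ∷ c ∷ d ∷ []))
  increasing₄ a<b b<c c<d d≤m = vertices-increasing
    ((a<b , below b<c (below c<d d≤m)) ∷ (b<c , below c<d d≤m) ∷ (c<d , d≤m) ∷ [-])

  irreducible⇒gaps-crossed : Irreducible G → GapsCrossed m adj
  irreducible⇒gaps-crossed irr {k} k<m
    with any? (λ i → (toℕ i ≤? k) ×-dec any? (λ j → (k <? toℕ j) ×-dec (G i j ≟ᵇ true)))
  ... | yes (i , i≤k , j , k<j , e) =
    toℕ i , toℕ j , i≤k , k<j , ≤-pred (toℕ<n j) , trans (adj-toℕ i j) e
  ... | no uncrossed =
    ⊥-elim (irr (vertex k) (vertex (suc k)) (vertex-mono-< ≤-refl k<m , separated))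
    where
    separated : ∀ i j → i <ᶠ j → G i j ≡ true → j ≤ᶠ vertex k ⊎ vertex (suc k) ≤ᶠ i
    separated i j _ e with toℕ i ≤? k | toℕ j ≤? k
    ... | _ | yes j≤k = inj₁ (subst (toℕ j ≤_) (sym (toℕ-vertex (<⇒≤ k<m))) j≤k)
    ... | yes i≤k | no j≰k = ⊥-elim (uncrossed (i , i≤k , j , ≰⇒> j≰k , e))
    ... | no i≰k | _ = inj₂ (subst (_≤ toℕ i) (sym (toℕ-vertex k<m)) (≰⇒> i≰k))

  irreducible₃⇒irreducible : ∀ a b c → Irreducible₃ adj a b c →
    Irreducible (subgraph (a ∷ b ∷ c ∷ []))
  irreducible₃⇒irreducible _ _ _ (inj₁ eac) zero _ =
    crossing-edge⇒¬separates _ zero (suc (suc zero)) z<s eac z≤n z<s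
  irreducible₃⇒irreducible _ _ _ (inj₁ eac) (suc zero) _ =
    crossing-edge⇒¬separates _ zero (suc (suc zero)) z<s eac z≤n (s<s z<s)
  irreducible₃⇒irreducible _ _ _ (inj₂ (eab , _)) zero _ =
    crossing-edge⇒¬separates _ zero (suc zero) z<s eab z≤n z<s
  irreducible₃⇒irreducible _ _ _ (inj₂ (_ , ebc)) (suc zero) _ =
    crossing-edge⇒¬separates _ (suc zero) (suc (suc zero)) (s<s z<s) ebc ≤-refl (s<s z<s)
  irreducible₃⇒irreducible _ _ _ _ (suc (suc zero)) v (u<v , _) = <⇒≱ u<v (≤-pred (toℕ<n v))

  crossing₄⇒irreducible : ∀ a b c d → Crossing₄ adj a b c d →
    Irreducible (subgraph (a ∷ b ∷ c ∷ d ∷ []))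
  crossing₄⇒irreducible _ _ _ _ (inj₁ ead) zero _ =
    crossing-edge⇒¬separates _ zero (suc (suc (suc zero))) z<s ead z≤n z<s
  crossing₄⇒irreducible _ _ _ _ (inj₁ ead) (suc zero) _ =
    crossing-edge⇒¬separates _ zero (suc (suc (suc zero))) z<s ead z≤n (s<s z<s)
  crossing₄⇒irreducible _ _ _ _ (inj₁ ead) (suc (suc zero)) _ =
    crossing-edge⇒¬separates _ zero (suc (suc (suc zero))) z<s ead z≤n (s<s (s<s z<s))
  crossing₄⇒irreducible _ _ _ _ (inj₂ (eac , _)) zero _ =
    crossing-edge⇒¬separates _ zero (suc (suc zero)) z<s eac z≤n z<s
  crossing₄⇒irreducible _ _ _ _ (inj₂ (eac , _)) (suc zero) _ =
    crossing-edge⇒¬separates _ zero (suc (suc zero)) z<s eac z≤n (s<s z<s)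
  crossing₄⇒irreducible _ _ _ _ (inj₂ (_ , ebd)) (suc (suc zero)) _ =
    crossing-edge⇒¬separates _ (suc zero) (suc (suc (suc zero))) (s<s z<s) ebd (s≤s z≤n)
      (s<s (s<s z<s))
  crossing₄⇒irreducible _ _ _ _ _ (suc (suc (suc zero))) v (u<v , _) = <⇒≱ u<v (≤-pred (toℕ<n v))

  atMostOne₃⇒unique : AtMostOneIrredInduced 3 G → UniqueIrreducible₃ m adj
  atMostOne₃⇒unique one₃ {a} {b} {c} {a′} {b′} {c′} a<b b<c c≤m a′<b′ b′<c′ c′≤m irr irr′ =
    same zero (suc zero) z<s , same zero (suc (suc zero)) z<s ,
    same (suc zero) (suc (suc zero)) (s<s z<s)
    where
    same : subgraph (a ∷ b ∷ c ∷ []) ≅ subgraph (a′ ∷ b′ ∷ c′ ∷ [])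
    same = one₃ _ _ (increasing₃ a<b b<c c≤m) (increasing₃ a′<b′ b′<c′ c′≤m)
      (irreducible₃⇒irreducible a b c irr) (irreducible₃⇒irreducible a′ b′ c′ irr′)

  atMostOne₄⇒unique : AtMostOneIrredInduced 4 G → UniqueCrossing₄ m adj
  atMostOne₄⇒unique one₄ {a} {b} {c} {d} {a′} {b′} {c′} {d′}
                    a<b b<c c<d d≤m a′<b′ b′<c′ c′<d′ d′≤m cr cr′ =
    same (suc zero) (suc (suc zero)) (s<s z<s) , same zero (suc (suc (suc zero))) z<s
    where
    same : subgraph (a ∷ b ∷ c ∷ d ∷ []) ≅ subgraph (a′ ∷ b′ ∷ c′ ∷ d′ ∷ [])
    same = one₄ _ _ (increasing₄ a<b b<c c<d d≤m) (increasing₄ a′<b′ b′<c′ c′<d′ d′≤m)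
      (crossing₄⇒irreducible a b c d cr) (crossing₄⇒irreducible a′ b′ c′ d′ cr′)

  agree⇒≅ : ∀ {h} → Agree m adj h → G ≅ λ i j → h (toℕ i) (toℕ j)
  agree⇒≅ agree i j i<j = trans (sym (adj-toℕ i j)) (agree i<j (≤-pred (toℕ<n j)))

  inJᴺ⇒inJ : InJᴺ m adj → InJ G
  inJᴺ⇒inJ = Sum.map agree⇒≅ (Sum.map agree⇒≅ (Sum.map agree⇒≅ (Sum.map agree⇒≅
    (Sum.map agree⇒≅ (Sum.map (map₂ agree⇒≅) (map₂ agree⇒≅))))))

lemma5p5 : (n : ℕ) (G : OGraph n) → Irreducible G →
    AtMostOneIrredInduced 3 G → AtMostOneIrredInduced 4 G → InJ G
lemma5p5 zero G _ _ _ = inj₁ λ ()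
lemma5p5 (suc m) G irr one₃ one₄ = inJᴺ⇒inJ
  (classifyᴺ m adj (irreducible⇒gaps-crossed irr) (atMostOne₃⇒unique one₃) (atMostOne₄⇒unique one₄))
  where open OnVertexNumbers G
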